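{- The set of semi-magic Sudoku boards splits into exactly three orbits under the action of $G_{sm}=H_9\times S_{sm}$.
   Context: A Sudoku board here is a $9\times 9$ grid with entries from $\{0,\dots,8\}$ such that each row, column and designated $3\times 3$ block contains each symbol once. A semi-magic square is a $3\times 3$ array containing each of $0,\dots,8$ once with every row and column summing to $12$. A semi-magic Sudoku board is a Sudoku board all of whose blocks are semi-magic squares. $H_9$ is the group of permutations of the $81$ cells generated by permutations of the bands (rows of blocks), permutations of the pillars (columns of blocks), permutations of rows within a band, permutations of columns within a pillar, and transpose (order $3{,}359{,}232$); it acts by moving entries. $S_{sm}$ is the group of permutations $\sigma$ of $\{0,\dots,8\}$ such that applying $\sigma$ to every entry of any semi-magic Sudoku board yields a semi-magic Sudoku board (it has order $72$). $G_{sm}=H_9\times S_{sm}$ acts on the set of semi-magic Sudoku boards. -}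

module Defs where

open import Data.Nat using (ℕ; _+_)
open import Data.Fin using (Fin; toℕ; _≟_)
open import Data.Fin.Patterns using (0F; 1F; 2F)
open import Data.Fin.Permutation using (Permutation′; _⟨$⟩ʳ_)
open import Data.Product using (Σ; _×_; _,_; ∃)
open import Data.Bool using (if_then_else_)
open import Relation.Nullary using (does)
open import Relation.Binary.PropositionalEquality using (_≡_)

-- A row index is (band, row within band); a column index is (pillar, column within pillar).
Idx : Set
Idx = Fin 3 × Fin 3

Cell : Set
Cell = Idx × Idx

Symbol : Set
Symbol = Fin 9

Grid : Set
Grid = Cell → Symbol

EachOnce : {A : Set} → (A → Symbol) → Set
EachOnce {A} f = ∀ (s : Symbol) → Σ A λ i → (f i ≡ s) × (∀ j → f j ≡ s → j ≡ i)

IsSudoku : Grid → Set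
IsSudoku B =
  (∀ (r : Idx) → EachOnce (λ (c : Idx) → B (r , c))) ×
  (∀ (c : Idx) → EachOnce (λ (r : Idx) → B (r , c))) ×
  (∀ (p q : Fin 3) → EachOnce (λ (ij : Fin 3 × Fin 3) →
        let (i , j) = ij in B ((p , i) , (q , j))))

sum3 : (Fin 3 → Symbol) → ℕ
sum3 f = toℕ (f 0F) + toℕ (f 1F) + toℕ (f 2F)

IsSemiMagic : (Fin 3 → Fin 3 → Symbol) → Set
IsSemiMagic M =
  EachOnce (λ (ij : Fin 3 × Fin 3) → let (i , j) = ij in M i j) ×
  (∀ i → sum3 (λ j → M i j) ≡ 12) ×
  (∀ j → sum3 (λ i → M i j) ≡ 12)

block : Grid → Fin 3 → Fin 3 → (Fin 3 → Fin 3 → Symbol)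
block B p q i j = B ((p , i) , (q , j))

IsSemiMagicSudoku : Grid → Set
IsSemiMagicSudoku B = IsSudoku B × (∀ p q → IsSemiMagic (block B p q))

-- Words in the generators of H₉.
data HWord : Set where
  idW       : HWord
  bands     : Permutation′ 3 → HWord
  pillars   : Permutation′ 3 → HWord
  rowsIn    : Fin 3 → Permutation′ 3 → HWord
  colsIn    : Fin 3 → Permutation′ 3 → HWord
  transpose : HWord
  _·_       : HWord → HWord → HWord

permWithin : Fin 3 → Permutation′ 3 → Idx → Idx
permWithin b π (b' , i) = if does (b' ≟ b) then (b' , π ⟨$⟩ʳ i) else (b' , i)

cellMap : HWord → Cell → Cell
cellMap idW x = x
cellMap (bands π) ((b , i) , c) = ((π ⟨$⟩ʳ b , i) , c)
cellMap (pillars π) (r , (p , j)) = (r , (π ⟨$⟩ʳ p , j))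
cellMap (rowsIn b π) (r , c) = (permWithin b π r , c)
cellMap (colsIn p π) (r , c) = (r , permWithin p π c)
cellMap transpose (r , c) = (c , r)
cellMap (g · h) x = cellMap g (cellMap h x)

InSsm : Permutation′ 9 → Set
InSsm σ = ∀ (B : Grid) → IsSemiMagicSudoku B → IsSemiMagicSudoku (λ x → σ ⟨$⟩ʳ B x)

SameOrbit : Grid → Grid → Set
SameOrbit B B' = Σ HWord λ h → Σ (Permutation′ 9) λ σ →
  InSsm σ × (∀ (x : Cell) → B' x ≡ σ ⟨$⟩ʳ B (cellMap h x))

module Submission where

-- Coordinates inside a band or pillar are treated as elements of Z/3, whose
-- permutations are the affine maps x ↦ ±x + b.
-- 1. Squares.  The semi-magic squares are exactly the 72 squares obtained from
--    one model square or its transpose by permuting rows and columns (one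
--    direction by an exhaustive search over candidate rows, the other directly).
-- 2. Structure.  Blocks in one band of a semi-magic Sudoku board have disjoint
--    corresponding rows, which forces a common orientation and row permutations
--    that are translates of one another; dually for pillars.  So, up to
--    relabelling rows within bands and columns within pillars, every board is a
--    normal form (R, v, w): cell ((p,i),(q,j)) holds model_R(i ± q, j ± p) with a
--    sign v p per band and w q per pillar.
-- 3. Coverage.  Six moves realised in G_sm (relabelling symbols, transposing,
--    mirroring and rotating bands or pillars) bring every normal form to one of
--    three canonical ones.
-- 4. Separation.  The number of directions (bands, pillars) whose signs are not
--    all equal is an invariant: this affine description of a board is carried
--    along by every generator of H₉ and every element of S_sm, and the number
--    can be read off the board.  The canonical boards have invariants 0, 1, 2.

open import Defs
open import Data.Bool using (Bool; true; false; not; _∧_; if_then_else_)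
open import Data.Bool.Properties using (not-injective; not-involutive) renaming (_≟_ to _≟ᴮ_)
open import Data.Fin using (Fin; toℕ)
import Data.Fin.Permutation as Perm
open import Data.Fin.Permutation using (Permutation′; _⟨$⟩ʳ_; _⟨$⟩ˡ_; _∘ₚ_; permutation; inverseˡ; inverseʳ)
open import Data.Fin.Patterns using (0F; 1F; 2F; 3F; 4F; 5F; 6F; 7F; 8F)
open import Data.Fin.Properties using (all?; any?) renaming (_≟_ to _≟ᶠ_)
open import Data.List using (List; []; _∷_; allFin; filter; cartesianProduct)
open import Data.List.Membership.Propositional using (_∈_)
open import Data.List.Membership.Propositional.Properties using (∈-filter⁺; ∈-allFin; ∈-cartesianProduct⁺)
import Data.List.Relation.Unary.All as All
import Data.List.Relation.Unary.Any as Any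
open import Data.Nat using (ℕ; zero; suc; _+_)
import Data.Nat.Properties as ℕ
open import Data.Product using (Σ; _×_; _,_; proj₁; proj₂)
open import Data.Sum using (_⊎_; inj₁; inj₂)
open import Data.Maybe using (Maybe; just; nothing)
open import Function using (_∘_; case_of_)
open import Data.Product.Properties using (≡-dec)
open import Relation.Binary.PropositionalEquality
open import Relation.Nullary using (does; Dec; ¬_; ¬?; _×-dec_; _⊎-dec_; _→-dec_)
open import Relation.Nullary.Decidable using (toWitness; map′)
open import Relation.Unary using (Decidable)

cong₃ : ∀ {A B C D : Set} (f : A → B → C → D) {a a' b b' c c'} → a ≡ a' → b ≡ b' → c ≡ c' → f a b c ≡ f a' b' c'
cong₃ f refl refl refl = refl

-- Quantification over Bool is decidable.  Together with all?/any? on Fin this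
-- lets identities about finitely many F3/Bool variables be proved by evaluation.
∀-Bool? : {P : Bool → Set} → Decidable P → Dec (∀ b → P b)
∀-Bool? P? = map′ (λ { (t , f) true → t ; (t , f) false → f }) (λ h → h true , h false) (P? true ×-dec P? false)

∃-Bool? : {P : Bool → Set} → Decidable P → Dec (Σ Bool P)
∃-Bool? P? = map′ (λ { (inj₁ t) → true , t ; (inj₂ f) → false , f }) (λ { (true , t) → inj₁ t ; (false , f) → inj₂ f })
  (P? true ⊎-dec P? false)

F3 : Set
F3 = Fin 3

infixl 6 _⊕_
_⊕_ : F3 → F3 → F3
x  ⊕ 0F = x
0F ⊕ 1F = 1F
1F ⊕ 1F = 2F
2F ⊕ 1F = 0F
0F ⊕ 2F = 2F
1F ⊕ 2F = 0F
2F ⊕ 2F = 1F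

⊖_ : F3 → F3
⊖ 0F = 0F
⊖ 1F = 2F
⊖ 2F = 1F

⊕-comm : ∀ x y → x ⊕ y ≡ y ⊕ x
⊕-comm = toWitness {a? = all? λ x → all? λ y → (x ⊕ y) ≟ᶠ (y ⊕ x)} _

0≢1 : _≢_ {A = F3} 0F 1F
0≢1 ()

0≢2 : _≢_ {A = F3} 0F 2F
0≢2 ()

1≢2 : _≢_ {A = F3} 1F 2F
1≢2 ()

signed : Bool → F3 → F3
signed true q = q
signed false q = ⊖ q

-- The permutations of Z/3 are exactly the affine maps x ↦ ±x + b.
Aff : Set
Aff = Bool × F3

affine : Aff → F3 → F3
affine (e , b) x = signed e x ⊕ b

affine⁻¹ : Aff → F3 → F3
affine⁻¹ (e , b) y = signed e (y ⊕ ⊖ b)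

∀-Aff? : {P : Aff → Set} → Decidable P → Dec (∀ a → P a)
∀-Aff? P? = map′ (λ h (e , b) → h e b) (λ h e b → h (e , b)) (∀-Bool? λ e → all? λ b → P? (e , b))

∃-Aff? : {P : Aff → Set} → Decidable P → Dec (Σ Aff P)
∃-Aff? P? = map′ (λ (e , b , p) → (e , b) , p) (λ ((e , b) , p) → e , b , p) (∃-Bool? λ e → any? λ b → P? (e , b))

affine-inverseˡ : ∀ a x → affine⁻¹ a (affine a x) ≡ x
affine-inverseˡ = toWitness {a? = ∀-Aff? λ a → all? λ x → affine⁻¹ a (affine a x) ≟ᶠ x} _

affine-inverseʳ : ∀ a y → affine a (affine⁻¹ a y) ≡ y
affine-inverseʳ = toWitness {a? = ∀-Aff? λ a → all? λ y → affine a (affine⁻¹ a y) ≟ᶠ y} _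

-- Signs compose multiplicatively: s ⊙ e is the sign of ±(±p).
_⊙_ : Bool → Bool → Bool
true ⊙ e = e
false ⊙ e = not e

⊕-cancelʳ : ∀ {x y z} → x ⊕ z ≡ y ⊕ z → x ≡ y
⊕-cancelʳ {x} {y} {z} = toWitness {a? = all? λ x → all? λ y → all? λ z → ((x ⊕ z) ≟ᶠ (y ⊕ z)) →-dec (x ≟ᶠ y)} _ x y z

affine-injective : ∀ a {x y} → affine a x ≡ affine a y → x ≡ y
affine-injective a {x} {y} e = trans (sym (affine-inverseˡ a x)) (trans (cong (affine⁻¹ a) e) (affine-inverseˡ a y))

affine-⊕ : ∀ a x s q → affine a (x ⊕ signed s q) ≡ affine a x ⊕ signed (s ⊙ proj₁ a) q
affine-⊕ = toWitness {a? = ∀-Aff? λ a → all? λ x → ∀-Bool? λ s → all? λ q →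
  affine a (x ⊕ signed s q) ≟ᶠ (affine a x ⊕ signed (s ⊙ proj₁ a) q)} _

⊕-signed-affine : ∀ x s a p → x ⊕ signed s (affine a p) ≡ (x ⊕ signed s (proj₂ a)) ⊕ signed (s ⊙ proj₁ a) p
⊕-signed-affine = toWitness {a? = all? λ x → ∀-Bool? λ s → ∀-Aff? λ a → all? λ p →
  (x ⊕ signed s (affine a p)) ≟ᶠ ((x ⊕ signed s (proj₂ a)) ⊕ signed (s ⊙ proj₁ a) p)} _

base : F3 → F3 → Symbol
base 0F 0F = 0F
base 0F 1F = 8F
base 0F 2F = 4F
base 1F 0F = 5F
base 1F 1F = 1F
base 1F 2F = 6F
base 2F 0F = 7F
base 2F 1F = 3F
base 2F 2F = 2F

model : Bool → F3 → F3 → Symbol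
model true x y = base x y
model false x y = base y x

model-transpose : ∀ R x y → model R x y ≡ model (not R) y x
model-transpose true x y = refl
model-transpose false x y = refl

-- The 72 semi-magic squares: the model with rows and columns relabelled by
-- permutations of Z/3.
SquareCode : Set
SquareCode = Bool × Aff × Aff

orientation : SquareCode → Bool
orientation = proj₁

rowPerm colPerm : SquareCode → Aff
rowPerm = proj₁ ∘ proj₂
colPerm = proj₂ ∘ proj₂

square : SquareCode → F3 → F3 → Symbol
square s i j = model (orientation s) (affine (rowPerm s) i) (affine (colPerm s) j)

_³ : Set → Set
A ³ = A × A × A

_!_ : ∀ {A : Set} → A ³ → F3 → A
(a , b , c) ! 0F = a
(a , b , c) ! 1F = b
(a , b , c) ! 2F = c

tabulate : ∀ {A : Set} → (F3 → A) → A ³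
tabulate f = f 0F , f 1F , f 2F

!-tabulate : ∀ {A : Set} (f : F3 → A) q → tabulate f ! q ≡ f q
!-tabulate f 0F = refl
!-tabulate f 1F = refl
!-tabulate f 2F = refl

tabulate-cong : ∀ {A : Set} {f g : F3 → A} → (∀ x → f x ≡ g x) → tabulate f ≡ tabulate g
tabulate-cong f≗g = cong₃ (λ a b c → a , b , c) (f≗g 0F) (f≗g 1F) (f≗g 2F)

-- Classification of semi-magic squares by an exhaustive search over triples
-- of candidate rows, pruned by disjointness and column sums.
Triple : Set
Triple = Symbol ³

rowsOf : (F3 → F3 → Symbol) → Triple ³
rowsOf M = tabulate λ i → tabulate (M i)

rowsOf-injective : ∀ {M N} → rowsOf M ≡ rowsOf N → ∀ i j → M i j ≡ N i j
rowsOf-injective {M} {N} e i j = begin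
  M i j                       ≡⟨ sym (!-tabulate (M i) j) ⟩
  tabulate (M i) ! j          ≡⟨ cong (_! j) (sym (!-tabulate (λ i → tabulate (M i)) i)) ⟩
  (rowsOf M ! i) ! j          ≡⟨ cong (λ rs → (rs ! i) ! j) e ⟩
  (rowsOf N ! i) ! j          ≡⟨ cong (_! j) (!-tabulate (λ i → tabulate (N i)) i) ⟩
  tabulate (N i) ! j          ≡⟨ !-tabulate (N i) j ⟩
  N i j                       ∎
  where open ≡-Reasoning

Disjoint : Triple → Triple → Set
Disjoint r r' = ∀ j j' → r ! j ≢ r' ! j'

disjoint? : ∀ r r' → Dec (Disjoint r r')
disjoint? r r' = all? λ j → all? λ j' → ¬? ((r ! j) ≟ᶠ (r' ! j'))

RowCandidate : Triple → Set
RowCandidate r = (∀ j j' → j ≢ j' → r ! j ≢ r ! j') × sum3 (r !_) ≡ 12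

rowCandidate? : ∀ r → Dec (RowCandidate r)
rowCandidate? r = (all? λ j → all? λ j' → ¬? (j ≟ᶠ j') →-dec ¬? ((r ! j) ≟ᶠ (r ! j'))) ×-dec (sum3 (r !_) ℕ.≟ 12)

ColumnSums : Triple → Triple → Triple → Set
ColumnSums r₀ r₁ r₂ = ∀ j → sum3 (λ i → ((r₀ , r₁ , r₂) ! i) ! j) ≡ 12

columnSums? : ∀ r₀ r₁ r₂ → Dec (ColumnSums r₀ r₁ r₂)
columnSums? r₀ r₁ r₂ = all? λ j → sum3 (λ i → ((r₀ , r₁ , r₂) ! i) ! j) ℕ.≟ 12

symbols : List Symbol
symbols = allFin 9

rowCandidates : List Triple
rowCandidates = filter rowCandidate? (cartesianProduct symbols (cartesianProduct symbols symbols))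

squareCodes : List SquareCode
squareCodes = cartesianProduct bools (cartesianProduct affs affs)
  where
  bools : List Bool
  bools = true ∷ false ∷ []
  affs : List Aff
  affs = cartesianProduct bools (allFin 3)

IsSquare : Triple → Triple → Triple → Set
IsSquare r₀ r₁ r₂ = Any.Any (λ s → (r₀ , r₁ , r₂) ≡ rowsOf (square s)) squareCodes

-- The check is stated for an arbitrary list of candidate rows so that the
-- candidate list is computed once when the check is evaluated.
Completion : List Triple → Set
Completion rs = All.All (λ r₀ → All.All (λ r₁ → Disjoint r₀ r₁ → All.All (λ r₂ →
  ColumnSums r₀ r₁ r₂ → Disjoint r₀ r₂ → Disjoint r₁ r₂ → IsSquare r₀ r₁ r₂) rs) rs) rs

completion? : ∀ rs → Dec (Completion rs)
completion? rs = All.all? (λ r₀ → All.all? (λ r₁ → disjoint? r₀ r₁ →-dec All.all? (λ r₂ →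
  columnSums? r₀ r₁ r₂ →-dec disjoint? r₀ r₂ →-dec disjoint? r₁ r₂ →-dec
  Any.any? (λ s → rows≟ (r₀ , r₁ , r₂) (rowsOf (square s))) squareCodes) rs) rs) rs
  where
  triple≟ : (r r' : Triple) → Dec (r ≡ r')
  triple≟ = ≡-dec _≟ᶠ_ (≡-dec _≟ᶠ_ _≟ᶠ_)
  rows≟ : (rs rs' : Triple ³) → Dec (rs ≡ rs')
  rows≟ = ≡-dec triple≟ (≡-dec triple≟ triple≟)

-- The search (opaque, since only its statement is used).
opaque
  completion : Completion rowCandidates
  completion = toWitness {a? = completion? rowCandidates} _

eachOnce-injective : ∀ {A : Set} {f : A → Symbol} → EachOnce f → ∀ {x y} → f x ≡ f y → x ≡ y
eachOnce-injective {f = f} once {x} {y} e with once (f x)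
... | _ , _ , unique = trans (unique x refl) (sym (unique y (sym e)))

semiMagic-classification : ∀ M → IsSemiMagic M → Σ SquareCode λ s → ∀ i j → M i j ≡ square s i j
semiMagic-classification M (once , rowSum , colSum) =
  proj₁ found , rowsOf-injective (proj₂ found)
  where
  position : ∀ {i j i' j'} → M i j ≡ M i' j' → (i , j) ≡ (i' , j')
  position = eachOnce-injective once

  sameRow : ∀ i j j' → tabulate (M i) ! j ≡ tabulate (M i) ! j' → j ≡ j'
  sameRow i j j' e = cong proj₂ (position (trans (sym (!-tabulate (M i) j)) (trans e (!-tabulate (M i) j'))))

  disjoint : ∀ i i' → i ≢ i' → Disjoint (tabulate (M i)) (tabulate (M i'))
  disjoint i i' i≢i' j j' e = i≢i' (cong proj₁ (position (trans (sym (!-tabulate (M i) j)) (trans e (!-tabulate (M i') j')))))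

  candidate : ∀ i → tabulate (M i) ∈ rowCandidates
  candidate i = ∈-filter⁺ rowCandidate?
    (∈-cartesianProduct⁺ (∈-allFin _) (∈-cartesianProduct⁺ (∈-allFin _) (∈-allFin _)))
    ((λ j j' j≢j' e → j≢j' (sameRow i j j' e)) , rowSum i)

  columns : ColumnSums (tabulate (M 0F)) (tabulate (M 1F)) (tabulate (M 2F))
  columns 0F = colSum 0F
  columns 1F = colSum 1F
  columns 2F = colSum 2F

  found : Σ SquareCode λ s → rowsOf M ≡ rowsOf (square s)
  found = Any.satisfied
    (All.lookup (All.lookup (All.lookup completion (candidate 0F)) (candidate 1F) (disjoint 0F 1F λ ()))
      (candidate 2F) columns (disjoint 0F 2F λ ()) (disjoint 1F 2F λ ()))

coordinates : Symbol → F3 × F3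
coordinates 0F = 0F , 0F
coordinates 1F = 1F , 1F
coordinates 2F = 2F , 2F
coordinates 3F = 2F , 1F
coordinates 4F = 0F , 2F
coordinates 5F = 1F , 0F
coordinates 6F = 1F , 2F
coordinates 7F = 2F , 0F
coordinates 8F = 0F , 1F

model-rowSum : ∀ R x c → sum3 (λ j → model R x (affine c j)) ≡ 12
model-rowSum = toWitness {a? = ∀-Bool? λ R → all? λ x → ∀-Aff? λ c → sum3 (λ j → model R x (affine c j)) ℕ.≟ 12} _

model-colSum : ∀ R y a → sum3 (λ i → model R (affine a i) y) ≡ 12
model-colSum = toWitness {a? = ∀-Bool? λ R → all? λ y → ∀-Aff? λ a → sum3 (λ i → model R (affine a i) y) ℕ.≟ 12} _

eachOnce-inverse : ∀ {A : Set} {f : A → Symbol} (g : Symbol → A) →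
  (∀ s → f (g s) ≡ s) → (∀ x → g (f x) ≡ x) → EachOnce f
eachOnce-inverse g fg gf s = g s , fg s , λ x e → trans (sym (gf x)) (cong g e)

eachOnce-resp : ∀ {A : Set} {f g : A → Symbol} → (∀ x → f x ≡ g x) → EachOnce f → EachOnce g
eachOnce-resp f≗g once s with once s
... | x , fx≡s , unique = x , trans (sym (f≗g x)) fx≡s , λ y gy≡s → unique y (trans (f≗g y) gy≡s)

modelCoordinates : Bool → Symbol → F3 × F3
modelCoordinates true s = coordinates s
modelCoordinates false s = proj₂ (coordinates s) , proj₁ (coordinates s)

coordinates-model : ∀ R x y → modelCoordinates R (model R x y) ≡ (x , y)
coordinates-model = toWitness {a? = ∀-Bool? λ R → all? λ x → all? λ y →
  ≡-dec _≟ᶠ_ _≟ᶠ_ (modelCoordinates R (model R x y)) (x , y)} _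

model-coordinates : ∀ R s → model R (proj₁ (modelCoordinates R s)) (proj₂ (modelCoordinates R s)) ≡ s
model-coordinates = toWitness {a? = ∀-Bool? λ R → all? λ s →
  model R (proj₁ (modelCoordinates R s)) (proj₂ (modelCoordinates R s)) ≟ᶠ s} _

eachOnce-model : ∀ R α (β : F3 → Aff) →
  EachOnce (λ (qj : F3 × F3) → model R (affine α (proj₁ qj)) (affine (β (proj₁ qj)) (proj₂ qj)))
eachOnce-model R α β = eachOnce-inverse (decode ∘ modelCoordinates R) encode-decode decode-encode
  where
  decode : F3 × F3 → F3 × F3
  decode (x , y) = affine⁻¹ α x , affine⁻¹ (β (affine⁻¹ α x)) y

  encode-decode : ∀ s → model R (affine α (proj₁ (decode (modelCoordinates R s))))
    (affine (β (proj₁ (decode (modelCoordinates R s)))) (proj₂ (decode (modelCoordinates R s)))) ≡ s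
  encode-decode s = trans (cong₂ (model R) (affine-inverseʳ α _) (affine-inverseʳ (β _) _)) (model-coordinates R s)

  decode-encode : ∀ qj → decode (modelCoordinates R (model R (affine α (proj₁ qj)) (affine (β (proj₁ qj)) (proj₂ qj)))) ≡ qj
  decode-encode (q , j) = begin
    decode (modelCoordinates R (model R (affine α q) (affine (β q) j)))
      ≡⟨ cong decode (coordinates-model R _ _) ⟩
    (affine⁻¹ α (affine α q) , affine⁻¹ (β (affine⁻¹ α (affine α q))) (affine (β q) j))
      ≡⟨ cong (λ q' → q' , affine⁻¹ (β q') (affine (β q) j)) (affine-inverseˡ α q) ⟩
    (q , affine⁻¹ (β q) (affine (β q) j))
      ≡⟨ cong (q ,_) (affine-inverseˡ (β q) j) ⟩
    (q , j) ∎
    where open ≡-Reasoning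

square-semiMagic : ∀ s → IsSemiMagic (square s)
square-semiMagic (R , a , c) = eachOnce-model R a (λ _ → c) , (λ i → model-rowSum R (affine a i) c) , (λ j → model-colSum R (affine c j) a)

Signs : Set
Signs = Bool ³

∀-Signs? : {P : Signs → Set} → Decidable P → Dec (∀ v → P v)
∀-Signs? P? = map′ (λ h (a , b , c) → h a b c) (λ h a b c → h (a , b , c)) (∀-Bool? λ a → ∀-Bool? λ b → ∀-Bool? λ c → P? (a , b , c))

-- The normal-form boards: an orientation R and signs v (per band), w (per pillar).
-- Cell (p,i),(q,j) holds the model entry at (i ± q, j ± p); hence block (p,q)
-- is the model square shifted by (±q, ±p).
Params : Set
Params = Bool × Signs × Signs

∀-Params? : {P : Params → Set} → Decidable P → Dec (∀ π → P π)
∀-Params? P? = map′ (λ h (R , v , w) → h R v w) (λ h R v w → h (R , v , w)) (∀-Bool? λ R → ∀-Signs? λ v → ∀-Signs? λ w → P? (R , v , w))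

_≟ₚ_ : (π π' : Params) → Dec (π ≡ π')
_≟ₚ_ = ≡-dec _≟ᴮ_ (≡-dec signs≟ signs≟)
  where
  signs≟ : (v v' : Signs) → Dec (v ≡ v')
  signs≟ = ≡-dec _≟ᴮ_ (≡-dec _≟ᴮ_ _≟ᴮ_)

board : Params → Grid
board (R , v , w) ((p , i) , (q , j)) = model R (i ⊕ signed (v ! p) q) (j ⊕ signed (w ! q) p)

-- Every normal form is a semi-magic Sudoku board: each row and column reads the
-- model through permutations of Z/3, and each block is one of the 72 squares.
board-semiMagicSudoku : ∀ π → IsSemiMagicSudoku (board π)
board-semiMagicSudoku π@(R , v , w) = (rows , columns , blocks) , λ p q → square-semiMagic (blockCode p q)
  where
  blockCode : F3 → F3 → SquareCode
  blockCode p q = R , (true , signed (v ! p) q) , (true , signed (w ! q) p)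

  rows : ∀ r → EachOnce (λ c → board π (r , c))
  rows (p , i) = eachOnce-resp (λ (q , j) → cong (λ x → model R x (j ⊕ signed (w ! q) p)) (⊕-comm _ i))
    (eachOnce-model R (v ! p , i) (λ q → true , signed (w ! q) p))

  columns : ∀ c → EachOnce (λ r → board π (r , c))
  columns (q , j) = eachOnce-resp (λ (p , i) → trans (cong₂ (model (not R)) (⊕-comm _ j) refl) (sym (model-transpose R _ _)))
    (eachOnce-model (not R) (w ! q , j) (λ p → true , signed (v ! p) q))

  blocks : ∀ p q → EachOnce (λ (ij : F3 × F3) → let (i , j) = ij in board π ((p , i) , (q , j)))
  blocks p q = proj₁ (square-semiMagic (blockCode p q))

disjointRows : ∀ R x R' x' → (∀ y y' → model R x y ≢ model R' x' y') → R ≡ R' × x ≢ x'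
disjointRows = toWitness {a? = ∀-Bool? λ R → all? λ x → ∀-Bool? λ R' → all? λ x' →
  (all? λ y → all? λ y' → ¬? (model R x y ≟ᶠ model R' x' y')) →-dec ((R ≟ᴮ R') ×-dec ¬? (x ≟ᶠ x'))} _

Apart : Aff → Aff → Set
Apart a a' = ∀ i → affine a i ≢ affine a' i

apart? : ∀ a a' → Dec (Apart a a')
apart? a a' = all? λ i → ¬? (affine a i ≟ᶠ affine a' i)

sideBySide : ∀ s s' → (∀ i j j' → square s i j ≢ square s' i j') →
  orientation s ≡ orientation s' × Apart (rowPerm s) (rowPerm s')
sideBySide (R , a , c) (R' , a' , c') apart = proj₁ (rowsApart 0F) , λ i → proj₂ (rowsApart i)
  where
  rowsApart : ∀ i → R ≡ R' × affine a i ≢ affine a' i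
  rowsApart i = disjointRows R (affine a i) R' (affine a' i) λ y y' e →
    apart i (affine⁻¹ c y) (affine⁻¹ c' y')
      (trans (cong (model R _) (affine-inverseʳ c y)) (trans e (cong (model R' _) (sym (affine-inverseʳ c' y')))))

transposeCode : SquareCode → SquareCode
transposeCode (R , a , c) = not R , c , a

square-transpose : ∀ s i j → square s i j ≡ square (transposeCode s) j i
square-transpose (R , a , c) i j = model-transpose R _ _

stacked : ∀ s s' → (∀ j i i' → square s i j ≢ square s' i' j) →
  orientation s ≡ orientation s' × Apart (colPerm s) (colPerm s')
stacked s s' apart = not-injective (proj₁ transposed) , proj₂ transposed
  where
  transposed : not (orientation s) ≡ not (orientation s') × Apart (colPerm s) (colPerm s')
  transposed = sideBySide (transposeCode s) (transposeCode s')
    (λ j i i' e → apart j i i' (trans (square-transpose s i j) (trans e (sym (square-transpose s' i' j)))))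

Translates : (F3 → Aff) → Set
Translates a = Σ Bool λ v → ∀ q i → affine (a q) i ≡ affine (a 0F) i ⊕ signed v q

translates? : ∀ a → Dec (Translates a)
translates? a = ∃-Bool? λ v → all? λ q → all? λ i → affine (a q) i ≟ᶠ (affine (a 0F) i ⊕ signed v q)

opaque
  latinCheck : ∀ a₀ a₁ a₂ → Apart a₀ a₁ → Apart a₀ a₂ → Apart a₁ a₂ → Translates ((a₀ , a₁ , a₂) !_)
  latinCheck = toWitness {a? = ∀-Aff? λ a₀ → ∀-Aff? λ a₁ → ∀-Aff? λ a₂ →
    apart? a₀ a₁ →-dec apart? a₀ a₂ →-dec apart? a₁ a₂ →-dec translates? ((a₀ , a₁ , a₂) !_)} _

latinTriple : ∀ a → Apart (a 0F) (a 1F) → Apart (a 0F) (a 2F) → Apart (a 1F) (a 2F) → Translates a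
latinTriple a a₀₁ a₀₂ a₁₂ = let (v , translate) = latinCheck (a 0F) (a 1F) (a 2F) a₀₁ a₀₂ a₁₂ in
  v , λ q i → subst (λ b → affine b i ≡ affine (a 0F) i ⊕ signed v q) (!-tabulate a q) (translate q i)

withinBands : (F3 → Permutation′ 3) → HWord
withinBands π = rowsIn 0F (π 0F) · (rowsIn 1F (π 1F) · rowsIn 2F (π 2F))

withinBands-cell : ∀ π p i c → cellMap (withinBands π) ((p , i) , c) ≡ ((p , π p ⟨$⟩ʳ i) , c)
withinBands-cell π 0F i c = refl
withinBands-cell π 1F i c = refl
withinBands-cell π 2F i c = refl

withinPillars : (F3 → Permutation′ 3) → HWord
withinPillars π = colsIn 0F (π 0F) · (colsIn 1F (π 1F) · colsIn 2F (π 2F))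

withinPillars-cell : ∀ π r q j → cellMap (withinPillars π) (r , (q , j)) ≡ (r , (q , π q ⟨$⟩ʳ j))
withinPillars-cell π r 0F j = refl
withinPillars-cell π r 1F j = refl
withinPillars-cell π r 2F j = refl

perm-injective : ∀ (π : Permutation′ 3) {x y} → π ⟨$⟩ʳ x ≡ π ⟨$⟩ʳ y → x ≡ y
perm-injective π {x} {y} e = trans (sym (inverseˡ π)) (trans (cong (π ⟨$⟩ˡ_) e) (inverseˡ π))

affinePerm : Aff → Permutation′ 3
affinePerm a = permutation (affine a) (affine⁻¹ a) (affine-inverseʳ a) (affine-inverseˡ a)

opaque
  perm-affine : ∀ (β : Permutation′ 3) → Σ Aff λ a → ∀ x → β ⟨$⟩ʳ x ≡ affine a x
  perm-affine β =
    let (a , agrees) = check (β ⟨$⟩ʳ 0F) (β ⟨$⟩ʳ 1F) (β ⟨$⟩ʳ 2F)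
          (λ e → 0≢1 (perm-injective β e)) (λ e → 0≢2 (perm-injective β e)) (λ e → 1≢2 (perm-injective β e)) in
    a , λ x → trans (sym (!-tabulate (β ⟨$⟩ʳ_) x)) (agrees x)
    where
    check : ∀ b₀ b₁ b₂ → b₀ ≢ b₁ → b₀ ≢ b₂ → b₁ ≢ b₂ → Σ Aff λ a → ∀ x → (b₀ , b₁ , b₂) ! x ≡ affine a x
    check = toWitness {a? = all? λ b₀ → all? λ b₁ → all? λ b₂ →
      ¬? (b₀ ≟ᶠ b₁) →-dec ¬? (b₀ ≟ᶠ b₂) →-dec ¬? (b₁ ≟ᶠ b₂) →-dec
      ∃-Aff? λ a → all? λ x → (b₀ , b₁ , b₂) ! x ≟ᶠ affine a x} _

relabel : (F3 → Aff) → (F3 → Aff) → HWord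
relabel P Q = withinBands (affinePerm ∘ P) · withinPillars (affinePerm ∘ Q)

relabel-cell : ∀ P Q p i q j → cellMap (relabel P Q) ((p , i) , (q , j)) ≡ ((p , affine (P p) i) , (q , affine (Q q) j))
relabel-cell P Q p i q j = begin
  cellMap (withinBands (affinePerm ∘ P)) (cellMap (withinPillars (affinePerm ∘ Q)) ((p , i) , (q , j)))
    ≡⟨ cong (cellMap (withinBands (affinePerm ∘ P))) (withinPillars-cell (affinePerm ∘ Q) (p , i) q j) ⟩
  cellMap (withinBands (affinePerm ∘ P)) ((p , i) , (q , affine (Q q) j))
    ≡⟨ withinBands-cell (affinePerm ∘ P) p i _ ⟩
  ((p , affine (P p) i) , (q , affine (Q q) j)) ∎
  where open ≡-Reasoning

-- The blocks are squares (classification); blocks sharing a band have disjoint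
-- rows, so they share the orientation and their row permutations are
-- translates (latinTriple); dually for pillars.
normalForm : ∀ B → IsSemiMagicSudoku B → Σ Params λ π → Σ (F3 → Aff) λ P → Σ (F3 → Aff) λ Q →
  ∀ p i q j → B ((p , i) , (q , j)) ≡ board π ((p , affine (P p) i) , (q , affine (Q q) j))
normalForm B ((rowOnce , colOnce , _) , semiMagic) = (R , tabulate v , tabulate w) , P , Q , shape
  where
  code : F3 → F3 → SquareCode
  code p q = proj₁ (semiMagic-classification (block B p q) (semiMagic p q))

  isSquare : ∀ p q i j → B ((p , i) , (q , j)) ≡ square (code p q) i j
  isSquare p q = proj₂ (semiMagic-classification (block B p q) (semiMagic p q))

  sameBand : ∀ p q q' → q ≢ q' → ∀ i j j' → square (code p q) i j ≢ square (code p q') i j'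
  sameBand p q q' q≢q' i j j' e = q≢q' (cong proj₁ (eachOnce-injective (rowOnce (p , i))
    (trans (isSquare p q i j) (trans e (sym (isSquare p q' i j'))))))

  samePillar : ∀ q p p' → p ≢ p' → ∀ j i i' → square (code p q) i j ≢ square (code p' q) i' j
  samePillar q p p' p≢p' j i i' e = p≢p' (cong proj₁ (eachOnce-injective (colOnce (q , j))
    (trans (isSquare p q i j) (trans e (sym (isSquare p' q i' j))))))

  bandNeighbours : ∀ p q q' → q ≢ q' →
    orientation (code p q) ≡ orientation (code p q') × Apart (rowPerm (code p q)) (rowPerm (code p q'))
  bandNeighbours p q q' q≢q' = sideBySide (code p q) (code p q') (sameBand p q q' q≢q')

  pillarNeighbours : ∀ q p p' → p ≢ p' →
    orientation (code p q) ≡ orientation (code p' q) × Apart (colPerm (code p q)) (colPerm (code p' q))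
  pillarNeighbours q p p' p≢p' = stacked (code p q) (code p' q) (samePillar q p p' p≢p')

  R : Bool
  R = orientation (code 0F 0F)

  orientation-band : ∀ p q → orientation (code p q) ≡ orientation (code p 0F)
  orientation-band p 0F = refl
  orientation-band p 1F = sym (proj₁ (bandNeighbours p 0F 1F λ ()))
  orientation-band p 2F = sym (proj₁ (bandNeighbours p 0F 2F λ ()))

  orientation-pillar : ∀ p → orientation (code p 0F) ≡ R
  orientation-pillar 0F = refl
  orientation-pillar 1F = sym (proj₁ (pillarNeighbours 0F 0F 1F λ ()))
  orientation-pillar 2F = sym (proj₁ (pillarNeighbours 0F 0F 2F λ ()))

  bandTranslates : ∀ p → Translates (λ q → rowPerm (code p q))
  bandTranslates p = latinTriple (λ q → rowPerm (code p q)) (proj₂ (bandNeighbours p 0F 1F λ ()))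
    (proj₂ (bandNeighbours p 0F 2F λ ())) (proj₂ (bandNeighbours p 1F 2F λ ()))

  pillarTranslates : ∀ q → Translates (λ p → colPerm (code p q))
  pillarTranslates q = latinTriple (λ p → colPerm (code p q)) (proj₂ (pillarNeighbours q 0F 1F λ ()))
    (proj₂ (pillarNeighbours q 0F 2F λ ())) (proj₂ (pillarNeighbours q 1F 2F λ ()))

  v w : F3 → Bool
  v p = proj₁ (bandTranslates p)
  w q = proj₁ (pillarTranslates q)

  P Q : F3 → Aff
  P p = rowPerm (code p 0F)
  Q q = colPerm (code 0F q)

  shape : ∀ p i q j → B ((p , i) , (q , j)) ≡ board (R , tabulate v , tabulate w) ((p , affine (P p) i) , (q , affine (Q q) j))
  shape p i q j = begin
    B ((p , i) , (q , j))
      ≡⟨ isSquare p q i j ⟩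
    model (orientation (code p q)) (affine (rowPerm (code p q)) i) (affine (colPerm (code p q)) j)
      ≡⟨ cong₃ model (trans (orientation-band p q) (orientation-pillar p))
           (proj₂ (bandTranslates p) q i) (proj₂ (pillarTranslates q) p j) ⟩
    model R (affine (P p) i ⊕ signed (v p) q) (affine (Q q) j ⊕ signed (w q) p)
      ≡⟨ cong₂ (λ s t → model R (affine (P p) i ⊕ signed s q) (affine (Q q) j ⊕ signed t p))
           (sym (!-tabulate v p)) (sym (!-tabulate w q)) ⟩
    board (R , tabulate v , tabulate w) ((p , affine (P p) i) , (q , affine (Q q) j)) ∎
    where open ≡-Reasoning

orbit-trans : ∀ {A B C} → SameOrbit A B → SameOrbit B C → SameOrbit A C
orbit-trans (h₁ , σ₁ , σ₁∈S , B≡) (h₂ , σ₂ , σ₂∈S , C≡) =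
  (h₁ · h₂) , (σ₁ ∘ₚ σ₂) , (λ G isSMS → σ₂∈S _ (σ₁∈S G isSMS)) ,
  λ x → trans (C≡ x) (cong (σ₂ ⟨$⟩ʳ_) (B≡ (cellMap h₂ x)))

byCells : ∀ A B h → (∀ x → B x ≡ A (cellMap h x)) → SameOrbit A B
byCells A B h B≡ = h , Perm.id , (λ G isSMS → isSMS) , B≡

orbit-refl : ∀ A → SameOrbit A A
orbit-refl A = byCells A A idW λ _ → refl

bySymbols : ∀ A B σ → InSsm σ → (∀ x → B x ≡ σ ⟨$⟩ʳ A x) → SameOrbit A B
bySymbols A B σ σ∈S B≡ = idW , σ , σ∈S , B≡

eachOnce-perm : ∀ {A : Set} (σ : Permutation′ 9) {f : A → Symbol} → EachOnce f → EachOnce (λ x → σ ⟨$⟩ʳ f x)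
eachOnce-perm σ once s with once (σ ⟨$⟩ˡ s)
... | x , fx≡ , unique = x , trans (cong (σ ⟨$⟩ʳ_) fx≡) (inverseʳ σ) ,
  λ y σfy≡s → unique y (trans (sym (inverseˡ σ)) (cong (σ ⟨$⟩ˡ_) σfy≡s))

sum3-cong : ∀ {f g : F3 → Symbol} → (∀ j → f j ≡ g j) → sum3 f ≡ sum3 g
sum3-cong f≗g = cong₃ (λ a b c → toℕ a + toℕ b + toℕ c) (f≗g 0F) (f≗g 1F) (f≗g 2F)

semiMagic-resp : ∀ {M N} → (∀ i j → M i j ≡ N i j) → IsSemiMagic M → IsSemiMagic N
semiMagic-resp M≗N (once , rowSum , colSum) =
  eachOnce-resp (λ (i , j) → M≗N i j) once ,
  (λ i → trans (sym (sum3-cong (M≗N i))) (rowSum i)) ,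
  (λ j → trans (sym (sum3-cong (λ i → M≗N i j))) (colSum j))

-- The symbol permutation 3 ↔ 6, 4 ↔ 7, 5 ↔ 8 turns the model square into its
-- transpose.
transposeSymbol : Symbol → Symbol
transposeSymbol 3F = 6F
transposeSymbol 4F = 7F
transposeSymbol 5F = 8F
transposeSymbol 6F = 3F
transposeSymbol 7F = 4F
transposeSymbol 8F = 5F
transposeSymbol s = s

transposeSymbol-involutive : ∀ s → transposeSymbol (transposeSymbol s) ≡ s
transposeSymbol-involutive = toWitness {a? = all? λ s → transposeSymbol (transposeSymbol s) ≟ᶠ s} _

transposeSymbol-model : ∀ R x y → transposeSymbol (model R x y) ≡ model (not R) x y
transposeSymbol-model = toWitness {a? = ∀-Bool? λ R → all? λ x → all? λ y →
  transposeSymbol (model R x y) ≟ᶠ model (not R) x y} _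

τ : Permutation′ 9
τ = permutation transposeSymbol transposeSymbol transposeSymbol-involutive transposeSymbol-involutive

-- τ lies in S_sm: like every symbol permutation it keeps a Sudoku board Sudoku,
-- and maps each block, a square of some orientation, to the square of the
-- opposite orientation.
τ-inSsm : InSsm τ
τ-inSsm B ((rowOnce , colOnce , blockOnce) , semiMagic) =
  ((λ r → eachOnce-perm τ (rowOnce r)) , (λ c → eachOnce-perm τ (colOnce c)) , (λ p q → eachOnce-perm τ (blockOnce p q))) ,
  λ p q → let (s , isSquare) = semiMagic-classification (block B p q) (semiMagic p q) in
    semiMagic-resp (λ i j → sym (trans (cong transposeSymbol (isSquare i j))
        (transposeSymbol-model (orientation s) (affine (rowPerm s) i) (affine (colPerm s) j))))
      (square-semiMagic (not (orientation s) , rowPerm s , colPerm s))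

-- Operations on sign triples: negating every sign, and reindexing along
-- q ↦ −q and q ↦ q + 1.
negateSigns reverseSigns rotateSigns : Signs → Signs
negateSigns (a , b , c) = not a , not b , not c
reverseSigns (a , b , c) = a , c , b
rotateSigns (a , b , c) = b , c , a

negateSigns-! : ∀ v q → negateSigns v ! q ≡ not (v ! q)
negateSigns-! v 0F = refl
negateSigns-! v 1F = refl
negateSigns-! v 2F = refl

reverseSigns-! : ∀ v q → reverseSigns v ! (⊖ q) ≡ v ! q
reverseSigns-! v 0F = refl
reverseSigns-! v 1F = refl
reverseSigns-! v 2F = refl

rotateSigns-! : ∀ v q → rotateSigns v ! (q ⊕ 2F) ≡ v ! q
rotateSigns-! v 0F = refl
rotateSigns-! v 1F = refl
rotateSigns-! v 2F = refl

signed-negate : ∀ t q → signed (not t) (⊖ q) ≡ signed t q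
signed-negate = toWitness {a? = ∀-Bool? λ t → all? λ q → signed (not t) (⊖ q) ≟ᶠ signed t q} _

-- Shifting j by ±1 compensates for shifting p by −1 in j ± p.
signed-shift : ∀ t j p → (j ⊕ signed t 1F) ⊕ signed t (p ⊕ 2F) ≡ j ⊕ signed t p
signed-shift = toWitness {a? = ∀-Bool? λ t → all? λ j → all? λ p →
  ((j ⊕ signed t 1F) ⊕ signed t (p ⊕ 2F)) ≟ᶠ (j ⊕ signed t p)} _

mirror : Permutation′ 3
mirror = affinePerm (false , 0F)

translation : F3 → Permutation′ 3
translation c = affinePerm (true , c)

data Move : Set where
  flipOrientation transposeBoard negatePillars negateBands rotateBands rotatePillars : Move

apply : Move → Params → Params
apply flipOrientation (R , v , w) = not R , v , w
apply transposeBoard  (R , v , w) = not R , w , v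
apply negatePillars   (R , v , w) = R , negateSigns v , reverseSigns w
apply negateBands     (R , v , w) = R , reverseSigns v , negateSigns w
apply rotateBands     (R , v , w) = R , rotateSigns v , w
apply rotatePillars   (R , v , w) = R , v , rotateSigns w

-- Rotating the bands (pillars) changes each j ± p (i ± q) by a constant, which
-- is undone by translating the columns of each pillar (rows of each band).
move-sound : ∀ m π → SameOrbit (board (apply m π)) (board π)
move-sound flipOrientation π@(R , v , w) =
  bySymbols (board (not R , v , w)) (board π) τ τ-inSsm λ ((p , i) , (q , j)) →
    sym (trans (transposeSymbol-model (not R) _ _) (cong (λ R' → model R' _ _) (not-involutive R)))
move-sound transposeBoard π@(R , v , w) =
  byCells (board (not R , w , v)) (board π) transpose λ ((p , i) , (q , j)) →
    model-transpose R _ _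
move-sound negatePillars π@(R , v , w) =
  byCells (board (R , negateSigns v , reverseSigns w)) (board π) (pillars mirror) λ ((p , i) , (q , j)) →
    cong₂ (model R)
      (cong (i ⊕_) (trans (sym (signed-negate (v ! p) q)) (cong (λ t → signed t (⊖ q)) (sym (negateSigns-! v p)))))
      (cong (λ t → j ⊕ signed t p) (sym (reverseSigns-! w q)))
move-sound negateBands π@(R , v , w) =
  byCells (board (R , reverseSigns v , negateSigns w)) (board π) (bands mirror) λ ((p , i) , (q , j)) →
    cong₂ (model R)
      (cong (λ t → i ⊕ signed t q) (sym (reverseSigns-! v p)))
      (cong (j ⊕_) (trans (sym (signed-negate (w ! q) p)) (cong (λ t → signed t (⊖ p)) (sym (negateSigns-! w q)))))
move-sound rotateBands π@(R , v , w) =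
  byCells (board π') (board π) (bands (translation 2F) · withinPillars shifts) λ ((p , i) , (q , j)) →
    sym (trans (cong (board π' ∘ cellMap (bands (translation 2F))) (withinPillars-cell shifts (p , i) q j))
      (cong₂ (model R) (cong (λ t → i ⊕ signed t q) (rotateSigns-! v p)) (signed-shift (w ! q) j p)))
  where
  π' : Params
  π' = R , rotateSigns v , w
  shifts : F3 → Permutation′ 3
  shifts q = translation (signed (w ! q) 1F)
move-sound rotatePillars π@(R , v , w) =
  byCells (board π') (board π) (pillars (translation 2F) · withinBands shifts) λ ((p , i) , (q , j)) →
    sym (trans (cong (board π' ∘ cellMap (pillars (translation 2F))) (withinBands-cell shifts p i (q , j)))
      (cong₂ (model R) (signed-shift (v ! p) i q) (cong (λ t → j ⊕ signed t p) (rotateSigns-! w q))))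
  where
  π' : Params
  π' = R , v , rotateSigns w
  shifts : F3 → Permutation′ 3
  shifts p = translation (signed (v ! p) 1F)

-- How a sign triple is brought to (+,+,+) or (+,+,−): negate it when most signs
-- are −, otherwise rotate until the odd sign comes last.
data SignStep : Set where
  done negate rotate : SignStep

signStep : Signs → SignStep
signStep (true , true , _) = done
signStep (false , false , _) = negate
signStep (false , _ , false) = negate
signStep (_ , false , false) = negate
signStep _ = rotate

-- The next move towards a canonical parameter: fix the orientation, then the
-- band signs, then the pillar signs, and finally put the odd band first.
towards : SignStep → SignStep → Bool → Bool → Maybe Move
towards negate _ _ _ = just negatePillars
towards rotate _ _ _ = just rotateBands
towards done negate _ _ = just negateBands
towards done rotate _ _ = just rotatePillars
towards done done true false = just transposeBoard
towards done done _ _ = nothing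

nextMove : Params → Maybe Move
nextMove (false , _ , _) = just flipOrientation
nextMove (true , v , w) = towards (signStep v) (signStep w) (v ! 2F) (w ! 2F)

normalize : ℕ → Params → Params
normalize zero π = π
normalize (suc n) π with nextMove π
... | nothing = π
... | just m = normalize n (apply m π)

normalize-sound : ∀ n π → SameOrbit (board (normalize n π)) (board π)
normalize-sound zero π = orbit-refl (board π)
normalize-sound (suc n) π with nextMove π
... | nothing = orbit-refl (board π)
... | just m = orbit-trans {board (normalize n (apply m π))} (normalize-sound n (apply m π)) (move-sound m π)

-- The three canonical parameters: constant signs in both directions, in one
-- direction only, or in neither.
canonical₁ canonical₂ canonical₃ : Params
canonical₁ = true , (true , true , true) , (true , true , true)
canonical₂ = true , (true , true , false) , (true , true , true)
canonical₃ = true , (true , true , false) , (true , true , false)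

Canonical : Params → Set
Canonical π = π ≡ canonical₁ ⊎ π ≡ canonical₂ ⊎ π ≡ canonical₃

normalize-canonical : ∀ π → Canonical (normalize 9 π)
normalize-canonical = toWitness {a? = ∀-Params? λ π →
  (normalize 9 π ≟ₚ canonical₁) ⊎-dec (normalize 9 π ≟ₚ canonical₂) ⊎-dec (normalize 9 π ≟ₚ canonical₃)} _

orbitOfCanonical : ∀ B → IsSemiMagicSudoku B → Σ Params λ π → Canonical π × SameOrbit (board π) B
orbitOfCanonical B isSMS =
  let (π , P , Q , shape) = normalForm B isSMS in
  normalize 9 π , normalize-canonical π ,
  orbit-trans {board (normalize 9 π)} (normalize-sound 9 π) (byCells (board π) B (relabel P Q) λ ((p , i) , (q , j)) →
    trans (shape p i q j) (cong (board π) (sym (relabel-cell P Q p i q j))))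

mixedSigns : Signs → ℕ
mixedSigns (a , b , c) = if does (a ≟ᴮ b) ∧ does (b ≟ᴮ c) then 0 else 1

mixed : (F3 → Bool) → ℕ
mixed t = mixedSigns (tabulate t)

mixedSigns-affine : ∀ s a → mixedSigns (tabulate ((s !_) ∘ affine a)) ≡ mixedSigns s
mixedSigns-affine = toWitness {a? = ∀-Signs? λ s → ∀-Aff? λ a → mixedSigns (tabulate ((s !_) ∘ affine a)) ℕ.≟ mixedSigns s} _

mixedSigns-⊙ : ∀ a b c e → mixedSigns (a ⊙ e , b ⊙ e , c ⊙ e) ≡ mixedSigns (a , b , c)
mixedSigns-⊙ = toWitness {a? = ∀-Bool? λ a → ∀-Bool? λ b → ∀-Bool? λ c → ∀-Bool? λ e →
  mixedSigns (a ⊙ e , b ⊙ e , c ⊙ e) ℕ.≟ mixedSigns (a , b , c)} _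

mixed-cong : ∀ {t t'} → (∀ p → t p ≡ t' p) → mixed t ≡ mixed t'
mixed-cong t≗t' = cong mixedSigns (tabulate-cong t≗t')

mixed-perm : ∀ t (β : Permutation′ 3) → mixed (λ p → t (β ⟨$⟩ʳ p)) ≡ mixed t
mixed-perm t β = let (a , β≗a) = perm-affine β in
  trans (mixed-cong λ p → trans (cong t (β≗a p)) (sym (!-tabulate t _))) (mixedSigns-affine (tabulate t) a)

mixed-⊙ : ∀ t e → mixed (λ p → t p ⊙ e) ≡ mixed t
mixed-⊙ t e = mixedSigns-⊙ (t 0F) (t 1F) (t 2F) e

record Shaped (c : ℕ) (G : Grid) : Set where
  field
    R : Bool
    ℓ κ : F3 → F3 → F3
    t u : F3 → Bool
    ℓ-injective : ∀ p {i i'} → ℓ p i ≡ ℓ p i' → i ≡ i'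
    κ-injective : ∀ q {j j'} → κ q j ≡ κ q j' → j ≡ j'
    shape : ∀ p i q j → G ((p , i) , (q , j)) ≡ model R (ℓ p i ⊕ signed (t p) q) (κ q j ⊕ signed (u q) p)
    count : mixed t + mixed u ≡ c

board-shaped : ∀ R v w → Shaped (mixedSigns v + mixedSigns w) (board (R , v , w))
board-shaped R v w = record
  { R = R ; ℓ = λ _ i → i ; κ = λ _ j → j ; t = v !_ ; u = w !_
  ; ℓ-injective = λ _ e → e ; κ-injective = λ _ e → e ; shape = λ _ _ _ _ → refl ; count = refl }

shaped-resp : ∀ {c G G'} → (∀ x → G' x ≡ G x) → Shaped c G → Shaped c G'
shaped-resp G'≗G S = record
  { R = R ; ℓ = ℓ ; κ = κ ; t = t ; u = u ; ℓ-injective = ℓ-injective ; κ-injective = κ-injective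
  ; shape = λ p i q j → trans (G'≗G _) (shape p i q j) ; count = count }
  where open Shaped S

shaped-transpose : ∀ {c G} → Shaped c G → Shaped c (λ x → G (cellMap transpose x))
shaped-transpose S = record
  { R = not R ; ℓ = κ ; κ = ℓ ; t = u ; u = t ; ℓ-injective = κ-injective ; κ-injective = ℓ-injective
  ; shape = λ p i q j → trans (shape q j p i) (model-transpose R _ _)
  ; count = trans (ℕ.+-comm (mixed u) (mixed t)) count }
  where open Shaped S

-- Permuting the bands by an affine β = ±p + b permutes the band data, and
-- shifts the column labels by ±b while multiplying the pillar signs by ±.
shaped-bands : ∀ {c G} β → Shaped c G → Shaped c (λ x → G (cellMap (bands β) x))
shaped-bands β S = record
  { R = R ; ℓ = λ p → ℓ (β ⟨$⟩ʳ p) ; κ = λ q j → κ q j ⊕ signed (u q) (proj₂ a)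
  ; t = λ p → t (β ⟨$⟩ʳ p) ; u = λ q → u q ⊙ proj₁ a
  ; ℓ-injective = λ p → ℓ-injective (β ⟨$⟩ʳ p) ; κ-injective = λ q e → κ-injective q (⊕-cancelʳ e)
  ; shape = λ p i q j → trans (shape (β ⟨$⟩ʳ p) i q j) (cong (model R _)
      (trans (cong (λ z → κ q j ⊕ signed (u q) z) (β≗a p)) (⊕-signed-affine (κ q j) (u q) a p)))
  ; count = trans (cong₂ _+_ (mixed-perm t β) (mixed-⊙ u (proj₁ a))) count }
  where
  open Shaped S
  a : Aff
  a = proj₁ (perm-affine β)
  β≗a : ∀ p → β ⟨$⟩ʳ p ≡ affine a p
  β≗a = proj₂ (perm-affine β)

withinBand : F3 → Permutation′ 3 → F3 → F3 → F3
withinBand b π p i = if does (p ≟ᶠ b) then π ⟨$⟩ʳ i else i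

permWithin-split : ∀ b π p i → permWithin b π (p , i) ≡ (p , withinBand b π p i)
permWithin-split b π p i with does (p ≟ᶠ b)
... | true = refl
... | false = refl

withinBand-injective : ∀ b π p {i i'} → withinBand b π p i ≡ withinBand b π p i' → i ≡ i'
withinBand-injective b π p e with does (p ≟ᶠ b)
... | true = perm-injective π e
... | false = e

shaped-rows : ∀ {c G} b π → Shaped c G → Shaped c (λ x → G (cellMap (rowsIn b π) x))
shaped-rows {G = G} b π S = record
  { R = R ; κ = κ ; t = t ; u = u ; κ-injective = κ-injective ; count = count
  ; ℓ = λ p i → ℓ p (withinBand b π p i)
  ; ℓ-injective = λ p e → withinBand-injective b π p (ℓ-injective p e)
  ; shape = λ p i q j → trans (cong (λ r → G (r , (q , j))) (permWithin-split b π p i)) (shape p (withinBand b π p i) q j) }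
  where open Shaped S

shaped-word : ∀ {c G} h → Shaped c G → Shaped c (λ x → G (cellMap h x))
shaped-word idW S = S
shaped-word (bands β) S = shaped-bands β S
shaped-word (pillars β) S = shaped-transpose (shaped-bands β (shaped-transpose S))
shaped-word (rowsIn b π) S = shaped-rows b π S
shaped-word (colsIn b π) S = shaped-transpose (shaped-rows b π (shaped-transpose S))
shaped-word transpose S = shaped-transpose S
shaped-word (g · h) S = shaped-word h (shaped-word g S)

shaped-recolour : ∀ {c G} (S : Shaped c G) (f : Symbol → Symbol) (s : SquareCode) →
  (∀ X Y → f (model (Shaped.R S) X Y) ≡ square s X Y) → Shaped c (λ x → f (G x))
shaped-recolour S f (R' , α , γ) f-model = record
  { R = R' ; ℓ = λ p i → affine α (ℓ p i) ; κ = λ q j → affine γ (κ q j)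
  ; t = λ p → t p ⊙ proj₁ α ; u = λ q → u q ⊙ proj₁ γ
  ; ℓ-injective = λ p e → ℓ-injective p (affine-injective α e)
  ; κ-injective = λ q e → κ-injective q (affine-injective γ e)
  ; shape = λ p i q j → trans (cong f (shape p i q j))
      (trans (f-model _ _) (cong₂ (model R') (affine-⊕ α (ℓ p i) (t p) q) (affine-⊕ γ (κ q j) (u q) p)))
  ; count = trans (cong₂ _+_ (mixed-⊙ t (proj₁ α)) (mixed-⊙ u (proj₁ γ))) count }
  where open Shaped S

-- A symbol permutation in S_sm maps the model square (block (0,0) of the first
-- canonical board) to a semi-magic square, i.e. to one of the 72 squares, and
-- hence the model of either orientation to one of the 72 squares.
inSsm-model : ∀ σ → InSsm σ → ∀ R → Σ SquareCode λ s → ∀ X Y → σ ⟨$⟩ʳ model R X Y ≡ square s X Y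
inSsm-model σ σ∈S true = image
  where
  image : Σ SquareCode λ s → ∀ X Y → σ ⟨$⟩ʳ model true X Y ≡ square s X Y
  image = semiMagic-classification (block (λ x → σ ⟨$⟩ʳ board canonical₁ x) 0F 0F)
    (proj₂ (σ∈S _ (board-semiMagicSudoku canonical₁)) 0F 0F)
inSsm-model σ σ∈S false =
  let (s , σ-model) = inSsm-model σ σ∈S true in
  transposeCode s , λ X Y → trans (σ-model Y X) (square-transpose s Y X)

shaped-symbols : ∀ {c G} σ → InSsm σ → Shaped c G → Shaped c (λ x → σ ⟨$⟩ʳ G x)
shaped-symbols σ σ∈S S = let (s , σ-model) = inSsm-model σ σ∈S (Shaped.R S) in
  shaped-recolour S (σ ⟨$⟩ʳ_) s σ-model

orbit-shaped : ∀ {c A B} → SameOrbit A B → Shaped c A → Shaped c B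
orbit-shaped (h , σ , σ∈S , B≡) S = shaped-resp B≡ (shaped-symbols σ σ∈S (shaped-word h S))

-- The orientation is detected from two
-- cells in one row of block (0,0), the band and pillar signs from the row and
-- column coordinates of cells one pillar, resp. one band, apart.
sameBaseRow : Symbol → Symbol → Bool
sameBaseRow s s' = does (proj₁ (coordinates s) ≟ᶠ proj₁ (coordinates s'))

sameBaseRow-model : ∀ R X Y Y' → Y ≢ Y' → sameBaseRow (model R X Y) (model R X Y') ≡ R
sameBaseRow-model = toWitness {a? = ∀-Bool? λ R → all? λ X → all? λ Y → all? λ Y' →
  ¬? (Y ≟ᶠ Y') →-dec (sameBaseRow (model R X Y) (model R X Y') ≟ᴮ R)} _

signOf : F3 → F3 → Bool
signOf x₁ x₀ = does (x₁ ≟ᶠ x₀ ⊕ 1F)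

signOf-signed : ∀ x s → signOf (x ⊕ signed s 1F) (x ⊕ signed s 0F) ≡ s
signOf-signed = toWitness {a? = all? λ x → ∀-Bool? λ s → signOf (x ⊕ signed s 1F) (x ⊕ signed s 0F) ≟ᴮ s} _

orientationOf : Grid → Bool
orientationOf G = sameBaseRow (G ((0F , 0F) , (0F , 0F))) (G ((0F , 0F) , (0F , 1F)))

coordinatesOf : Grid → Cell → F3 × F3
coordinatesOf G x = modelCoordinates (orientationOf G) (G x)

bandSign pillarSign : Grid → F3 → Bool
bandSign G p = signOf (proj₁ (coordinatesOf G ((p , 0F) , (1F , 0F)))) (proj₁ (coordinatesOf G ((p , 0F) , (0F , 0F))))
pillarSign G q = signOf (proj₂ (coordinatesOf G ((1F , 0F) , (q , 0F)))) (proj₂ (coordinatesOf G ((0F , 0F) , (q , 0F))))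

readInvariant : Grid → ℕ
readInvariant G = mixed (bandSign G) + mixed (pillarSign G)

readInvariant-shaped : ∀ {c G} → Shaped c G → readInvariant G ≡ c
readInvariant-shaped {G = G} S = trans (cong₂ _+_ (mixed-cong bandSign≡t) (mixed-cong pillarSign≡u)) count
  where
  open Shaped S
  orientation≡R : orientationOf G ≡ R
  orientation≡R = trans (cong₂ sameBaseRow (shape 0F 0F 0F 0F) (shape 0F 0F 0F 1F))
    (sameBaseRow-model R _ _ _ λ e → 0≢1 (κ-injective 0F (⊕-cancelʳ e)))
  coordinates≡ : ∀ p i q j → coordinatesOf G ((p , i) , (q , j)) ≡ (ℓ p i ⊕ signed (t p) q , κ q j ⊕ signed (u q) p)
  coordinates≡ p i q j = trans (cong₂ modelCoordinates orientation≡R (shape p i q j)) (coordinates-model R _ _)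
  bandSign≡t : ∀ p → bandSign G p ≡ t p
  bandSign≡t p = trans (cong₂ signOf (cong proj₁ (coordinates≡ p 0F 1F 0F)) (cong proj₁ (coordinates≡ p 0F 0F 0F)))
    (signOf-signed (ℓ p 0F) (t p))
  pillarSign≡u : ∀ q → pillarSign G q ≡ u q
  pillarSign≡u q = trans (cong₂ signOf (cong proj₂ (coordinates≡ 1F 0F q 0F)) (cong proj₂ (coordinates≡ 0F 0F q 0F)))
    (signOf-signed (κ q 0F) (u q))

invariant : Params → ℕ
invariant (R , v , w) = mixedSigns v + mixedSigns w

orbit-invariant : ∀ π π' → SameOrbit (board π) (board π') → invariant π ≡ invariant π'
orbit-invariant (R , v , w) (R' , v' , w') o =
  trans (sym (readInvariant-shaped (orbit-shaped o (board-shaped R v w)))) (readInvariant-shaped (board-shaped R' v' w'))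

coverage : ∀ B → IsSemiMagicSudoku B →
  SameOrbit (board canonical₁) B ⊎ SameOrbit (board canonical₂) B ⊎ SameOrbit (board canonical₃) B
coverage B isSMS = let (π , canonical , o) = orbitOfCanonical B isSMS in fromCanonical canonical o
  where
  fromCanonical : ∀ {π} → Canonical π → SameOrbit (board π) B →
    SameOrbit (board canonical₁) B ⊎ SameOrbit (board canonical₂) B ⊎ SameOrbit (board canonical₃) B
  fromCanonical (inj₁ refl) o = inj₁ o
  fromCanonical (inj₂ (inj₁ refl)) o = inj₂ (inj₁ o)
  fromCanonical (inj₂ (inj₂ refl)) o = inj₂ (inj₂ o)

theorem4 : Σ Grid λ B₁ → Σ Grid λ B₂ → Σ Grid λ B₃ →
    IsSemiMagicSudoku B₁ × IsSemiMagicSudoku B₂ × IsSemiMagicSudoku B₃ ×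
    ¬ SameOrbit B₁ B₂ × ¬ SameOrbit B₁ B₃ × ¬ SameOrbit B₂ B₃ ×
    (∀ (B : Grid) → IsSemiMagicSudoku B →
      SameOrbit B₁ B ⊎ SameOrbit B₂ B ⊎ SameOrbit B₃ B)
theorem4 =
  board canonical₁ , board canonical₂ , board canonical₃ ,
  board-semiMagicSudoku canonical₁ , board-semiMagicSudoku canonical₂ , board-semiMagicSudoku canonical₃ ,
  (λ o → case orbit-invariant canonical₁ canonical₂ o of λ ()) ,
  (λ o → case orbit-invariant canonical₁ canonical₃ o of λ ()) ,
  (λ o → case orbit-invariant canonical₂ canonical₃ o of λ ()) ,
  coverage
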